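{- Let $n \ge 3$ and let $D_{2n} = \langle x, y \mid x^2 = 1,\ y^n = 1,\ yx = xy^{ -1}\rangle$ be the dihedral group of order $2n$. Let $S$ be a sequence of $n$ elements of $D_{2n}$. \begin{enumerate} \item If $n \ge 4$, then the following are equivalent: (i) $S$ is free of product-$1$ subsequences; (ii) there exist integers $t$ with $1 \le t \le n-1$ and $\gcd(t,n)=1$, and $s$ with $0 \le s \le n-1$, such that $S = (y^t, y^t, \dots, y^t, xy^s)$, where $y^t$ appears exactly $n-1$ times. \item If $n = 3$, then $S$ is free of product-$1$ subsequences if and only if either $S = (y^t, y^t, xy^{\nu})$ for some $t \in \{1,2\}$ and $\nu \in \{0,1,2\}$, or $S = (x, xy, xy^2)$. \end{enumerate}
   Context: A sequence in a finite group $G$ is a finite list $(g_1,\dots,g_l)$ of elements of $G$ with repetitions allowed; sequences are considered up to reordering of their terms. A subsequence is obtained by choosing a subset of the index set $\{1,\dots,l\}$. A non-empty subsequence $(g_{n_1},\dots,g_{n_k})$ is a product-$1$ subsequence if $g_{\sigma(n_1)} g_{\sigma(n_2)} \cdots g_{\sigma(n_k)} = 1$ for some permutation $\sigma$ of $\{n_1,\dots,n_k\}$. A sequence is free of product-$1$ subsequences if it has no non-empty product-$1$ subsequence. -}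

module Defs where

open import Data.Nat using (ℕ; _+_; _∸_; NonZero)
open import Data.Nat.DivMod using (_mod_)
open import Data.Fin using (Fin; toℕ)
open import Data.List using (List; []; _∷_; _++_; foldr)
open import Data.Product using (∃; ∃-syntax; _×_)
open import Relation.Binary.PropositionalEquality using (_≡_; _≢_)
open import Data.List.Relation.Binary.Permutation.Propositional using (_↭_)
open import Relation.Nullary using (¬_)

-- The dihedral group D_{2n} = ⟨ x, y | x² = 1, yⁿ = 1, yx = xy⁻¹ ⟩,
-- concretely: rot k = y^k, ref k = x y^k, k ∈ ℤ/n.
data D (n : ℕ) : Set where
  rot : Fin n → D n
  ref : Fin n → D n

module _ {n : ℕ} .{{_ : NonZero n}} where
  _⊕_ : Fin n → Fin n → Fin n
  a ⊕ b = (toℕ a + toℕ b) mod n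

  ⊖_ : Fin n → Fin n
  ⊖ a = (n ∸ toℕ a) mod n

  -- y^a y^b = y^(a+b); y^a x y^b = x y^(b-a);
  -- x y^a y^b = x y^(a+b); x y^a x y^b = y^(b-a)
  _·_ : D n → D n → D n
  rot a · rot b = rot (a ⊕ b)
  rot a · ref b = ref (b ⊕ (⊖ a))
  ref a · rot b = ref (a ⊕ b)
  ref a · ref b = rot (b ⊕ (⊖ a))

  one : D n
  one = rot (0 mod n)

  prod : List (D n) → D n
  prod = foldr _·_ one

  -- S has a product-1 subsequence: a nonempty sub-multiset of S (the terms L,
  -- listed in an arbitrary order, with the remaining terms R) whose product is 1.
  HasProduct1Subseq : List (D n) → Set
  HasProduct1Subseq S =
    ∃[ L ] ∃[ R ] ((S ↭ L ++ R) × (L ≢ []) × (prod L ≡ one))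

  Product1Free : List (D n) → Set
  Product1Free S = ¬ HasProduct1Subseq S

{-# OPTIONS --safe #-}
module Submission where

-- Split a product-1 free sequence S of length n into its rotations y^a (a ∈ As) and
-- its reflections x y^b (b ∈ Bs).  Freeness says that no sub-multiset of As sums to
-- 0 in ℤ/n, and, since x y^u · x y^v · y^l = y^(v + l - u), that v + Σ L ≠ u for
-- every sub-multiset L of As and every two terms u, v of Bs; in particular the terms
-- of Bs are distinct.  Prefix sums then produce more than n distinct residues in all
-- cases but two: one reflection and n - 1 rotations, which must all be equal to a
-- generator of ℤ/n, or n distinct reflections.  For n ≥ 4 the latter contain
-- x, x y, x y³, x y², whose product is 1; for n = 3 they are x, x y, x y².

open import Defs
open import Algebra.Bundles using (AbelianGroup; CommutativeMonoid)
open import Data.Empty using (⊥-elim)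
open import Data.Fin using (Fin; zero; suc; toℕ; #_)
open import Data.Fin.Properties using (toℕ-fromℕ<; toℕ-injective; toℕ<n; injective⇒≤; _≟_)
open import Data.List using (List; []; _∷_; _++_; length; map; replicate; foldr; lookup)
open import Data.List.Membership.Propositional using (_∈_; _∉_)
open import Data.List.Membership.Propositional.Properties using (∈-map⁻; ∈-∃++; ∈-lookup; ∈-++⁺ˡ; ∈-++⁺ʳ; ∈-++⁻)
open import Data.List.Properties using (length-++; length-map; length-replicate; map-++; map-replicate; ++-assoc)
open import Data.List.Relation.Binary.Disjoint.Propositional using (Disjoint)
open import Data.List.Relation.Binary.Permutation.Propositional
  using (_↭_; ↭-refl; ↭-sym; ↭-trans; ↭-reflexive; ↭-prep; ↭-swap; ↭⇒↭ₛ; module PermutationReasoning)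
open import Data.List.Relation.Binary.Permutation.Propositional.Properties
  using (shift; ++⁺; ++⁺ʳ; ++-comm; ++-identityʳ; map⁺; ↭-length; ∈-resp-↭; All-resp-↭; ++-commutativeMonoid)
open import Data.List.Relation.Unary.All as All using (All; []; _∷_)
open import Data.List.Relation.Unary.All.Properties using (¬Any⇒All¬)
open import Data.List.Relation.Unary.AllPairs using ([]; _∷_)
open import Data.List.Relation.Unary.Any using (here; there)
open import Data.List.Relation.Unary.Unique.Propositional using (Unique)
open import Data.List.Relation.Unary.Unique.Propositional.Properties using () renaming (map⁺ to Unique-map⁺; ++⁺ to Unique-++⁺)
open import Data.Nat using (ℕ; zero; suc; _+_; _*_; _∸_; _%_; _≤_; _<_; s≤s; z≤n; NonZero; z<s; >-nonZero; >-nonZero⁻¹)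
open import Data.Nat.ListAction using (sum)
open import Data.Nat.ListAction.Properties using (sum-++; sum-↭)
open import Data.Nat.Coprimality using (gcd≡1⇒coprime; coprime-divisor) renaming (sym to coprime-sym)
open import Data.Nat.Divisibility using (_∣_; divides; >⇒∤; m%n≡0⇒n∣m; n∣m⇒m%n≡0)
open import Data.Nat.DivMod using (_mod_; m<n⇒m%n≡m; %-distribˡ-+; m%n%n≡m%n; n%n≡0)
open import Data.Nat.GCD using (gcd; gcd[m,n]∣m; gcd[m,n]∣n)
open import Data.Nat.Properties
  using (+-comm; +-assoc; +-identityʳ; *-comm; *-assoc; *-zeroʳ; m+[n∸m]≡n; <⇒≤; <⇒≢; 1+n≰n;
         n≢0⇒n>0; m<m+n; m<m*n; m∸n+n≡m; ≤-trans; suc-injective; m≤m+n; suc[m]≤n⇒m≤pred[n])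
open import Data.Product using (∃₂; ∃-syntax; _×_; _,_; proj₂)
open import Data.Sum using (_⊎_; inj₁; inj₂)
open import Function using (_∘_)
open import Function.Bundles using (_⇔_; mk⇔; Equivalence)
open import Level using (0ℓ)
open import Relation.Binary.PropositionalEquality
open import Relation.Nullary using (¬_; yes; no; contradiction)

import Algebra.Properties.AbelianGroup as AbelianGroupProperties
import Algebra.Properties.CommutativeSemigroup as CommutativeSemigroupProperties
import Data.List.Membership.DecPropositional as DecMembership
import Data.List.Relation.Binary.Permutation.Setoid.Properties as PermutationSetoid

module _ {A : Set} where

  ∈⇒↭∷ : ∀ {x} {xs : List A} → x ∈ xs → ∃[ ys ] xs ↭ x ∷ ys
  ∈⇒↭∷ x∈ with ∈-∃++ x∈
  ... | P , Q , refl = P ++ Q , shift _ P Q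

  All≡⇒replicate : ∀ {x} {xs : List A} → All (x ≡_) xs → xs ≡ replicate (length xs) x
  All≡⇒replicate []         = refl
  All≡⇒replicate (refl ∷ p) = cong (_ ∷_) (All≡⇒replicate p)

  map≢[] : ∀ {B : Set} (f : A → B) {xs} → xs ≢ [] → map f xs ≢ []
  map≢[] f {[]}    xs≢[] _ = xs≢[] refl
  map≢[] f {_ ∷ _} _     ()

  ≢[]⇒0<length : ∀ {xs : List A} → xs ≢ [] → 0 < length xs
  ≢[]⇒0<length {[]}    xs≢[] = contradiction refl xs≢[]
  ≢[]⇒0<length {_ ∷ _} _     = z<s

  Unique-resp-↭ : ∀ {xs ys : List A} → xs ↭ ys → Unique xs → Unique ys
  Unique-resp-↭ p = PermutationSetoid.Unique-resp-↭ (setoid A) (↭⇒↭ₛ p)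

  unique⇒lookup-injective : ∀ {xs : List A} → Unique xs → ∀ {i j} → lookup xs i ≡ lookup xs j → i ≡ j
  unique⇒lookup-injective (_  ∷ _) {zero}  {zero}  _ = refl
  unique⇒lookup-injective (x∉ ∷ _) {zero}  {suc j} e = contradiction e (All.lookup x∉ (∈-lookup j))
  unique⇒lookup-injective (x∉ ∷ _) {suc i} {zero}  e = contradiction (sym e) (All.lookup x∉ (∈-lookup i))
  unique⇒lookup-injective (_  ∷ u) {suc i} {suc j} e = cong suc (unique⇒lookup-injective u e)

  unique-⊆⇒↭++ : ∀ {xs ys : List A} → Unique xs → (∀ {x} → x ∈ xs → x ∈ ys) → ∃[ zs ] ys ↭ xs ++ zs
  unique-⊆⇒↭++ {[]}     {ys} _          _  = ys , ↭-refl
  unique-⊆⇒↭++ {x ∷ xs} {ys} (x∉ ∷ u) xs⊆ with ∈⇒↭∷ (xs⊆ (here refl))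
  ... | ys′ , ys↭ with unique-⊆⇒↭++ u (λ y∈ → drop-x (∈-resp-↭ ys↭ (xs⊆ (there y∈))) (All.lookup x∉ y∈))
    where
    drop-x : ∀ {y} → y ∈ x ∷ ys′ → x ≢ y → y ∈ ys′
    drop-x (here y≡x) x≢y = contradiction (sym y≡x) x≢y
    drop-x (there y∈) _   = y∈
  ... | zs , ys′↭ = zs , ↭-trans ys↭ (↭-prep x ys′↭)

module _ {n : ℕ} where

  unique⇒length≤ : {xs : List (Fin n)} → Unique xs → length xs ≤ n
  unique⇒length≤ u = injective⇒≤ (unique⇒lookup-injective u)

  unique∧length≡n⇒∈ : {xs : List (Fin n)} → Unique xs → length xs ≡ n → ∀ k → k ∈ xs
  unique∧length≡n⇒∈ {xs} u len k with k ∈? xs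
    where open DecMembership _≟_
  ... | yes k∈ = k∈
  ... | no  k∉ = contradiction (subst (λ m → suc m ≤ n) len (unique⇒length≤ (¬Any⇒All¬ xs k∉ ∷ u))) 1+n≰n

coprime⇒∤* : ∀ {a n k} → gcd a n ≡ 1 → 0 < k → k < n → ¬ n ∣ k * a
coprime⇒∤* {a} {n} {suc k} g≡1 _ k<n n∣ka =
  >⇒∤ k<n (coprime-divisor (coprime-sym (gcd≡1⇒coprime {a} {n} g≡1)) (subst (n ∣_) (*-comm (suc k) a) n∣ka))

∤*⇒coprime : ∀ {a n} → 0 < n → (∀ {k} → 0 < k → k < n → ¬ n ∣ k * a) → gcd a n ≡ 1
∤*⇒coprime {a} {n} 0<n ∤ with gcd a n | gcd[m,n]∣m a n | gcd[m,n]∣n a n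
... | zero          | _               | divides q n≡q*0 = contradiction (trans n≡q*0 (*-zeroʳ q)) (<⇒≢ 0<n ∘ sym)
... | suc zero      | _               | _               = refl
... | suc (suc h)   | divides r a≡r*g | divides q n≡q*g = ⊥-elim (∤ 0<q q<n (divides r q*a≡r*n))
  where
  g = suc (suc h)
  0<q : 0 < q
  0<q = n≢0⇒n>0 (λ { refl → <⇒≢ 0<n (sym n≡q*g) })
  q<n : q < n
  q<n = subst (q <_) (sym n≡q*g) (m<m*n q g {{>-nonZero 0<q}} (s≤s (s≤s z≤n)))
  q*a≡r*n : q * a ≡ r * n
  q*a≡r*n = begin
    q * a       ≡⟨ cong (q *_) a≡r*g ⟩
    q * (r * g) ≡⟨ *-assoc q r g ⟨
    q * r * g   ≡⟨ cong (_* g) (*-comm q r) ⟩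
    r * q * g   ≡⟨ *-assoc r q g ⟩
    r * (q * g) ≡⟨ cong (r *_) n≡q*g ⟨
    r * n       ∎
    where open ≡-Reasoning

module _ {n : ℕ} .{{_ : NonZero n}} where

  𝟘 : Fin n
  𝟘 = 0 mod n

  [m%n+k]%n≡[m+k]%n : ∀ m k → (m % n + k) % n ≡ (m + k) % n
  [m%n+k]%n≡[m+k]%n m k = begin
    (m % n + k) % n         ≡⟨ %-distribˡ-+ (m % n) k n ⟩
    (m % n % n + k % n) % n ≡⟨ cong (λ r → (r + k % n) % n) (m%n%n≡m%n m n) ⟩
    (m % n + k % n) % n     ≡⟨ %-distribˡ-+ m k n ⟨
    (m + k) % n             ∎
    where open ≡-Reasoning

  [m+k%n]%n≡[m+k]%n : ∀ m k → (m + k % n) % n ≡ (m + k) % n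
  [m+k%n]%n≡[m+k]%n m k = begin
    (m + k % n) % n ≡⟨ cong (_% n) (+-comm m (k % n)) ⟩
    (k % n + m) % n ≡⟨ [m%n+k]%n≡[m+k]%n k m ⟩
    (k + m) % n     ≡⟨ cong (_% n) (+-comm k m) ⟩
    (m + k) % n     ∎
    where open ≡-Reasoning

  toℕ-mod : ∀ m → toℕ (m mod n) ≡ m % n
  toℕ-mod m = toℕ-fromℕ< _

  toℕ-⊕ : ∀ (a b : Fin n) → toℕ (a ⊕ b) ≡ (toℕ a + toℕ b) % n
  toℕ-⊕ a b = toℕ-mod (toℕ a + toℕ b)

  toℕ-𝟘 : toℕ 𝟘 ≡ 0
  toℕ-𝟘 = trans (toℕ-mod 0) (m<n⇒m%n≡m (>-nonZero⁻¹ n))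

  ⊕-comm : ∀ (a b : Fin n) → a ⊕ b ≡ b ⊕ a
  ⊕-comm a b = cong (_mod n) (+-comm (toℕ a) (toℕ b))

  ⊕-assoc : ∀ (a b c : Fin n) → (a ⊕ b) ⊕ c ≡ a ⊕ (b ⊕ c)
  ⊕-assoc a b c = toℕ-injective (begin
    toℕ ((a ⊕ b) ⊕ c)     ≡⟨ toℕ-⊕ (a ⊕ b) c ⟩
    (toℕ (a ⊕ b) + z) % n ≡⟨ cong (λ r → (r + z) % n) (toℕ-⊕ a b) ⟩
    ((x + y) % n + z) % n ≡⟨ [m%n+k]%n≡[m+k]%n (x + y) z ⟩
    (x + y + z) % n       ≡⟨ cong (_% n) (+-assoc x y z) ⟩
    (x + (y + z)) % n     ≡⟨ [m+k%n]%n≡[m+k]%n x (y + z) ⟨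
    (x + (y + z) % n) % n ≡⟨ cong (λ r → (x + r) % n) (toℕ-⊕ b c) ⟨
    (x + toℕ (b ⊕ c)) % n ≡⟨ toℕ-⊕ a (b ⊕ c) ⟨
    toℕ (a ⊕ (b ⊕ c))     ∎)
    where
    open ≡-Reasoning
    x = toℕ a
    y = toℕ b
    z = toℕ c

  ⊕-identityˡ : ∀ (a : Fin n) → 𝟘 ⊕ a ≡ a
  ⊕-identityˡ a = toℕ-injective (begin
    toℕ (𝟘 ⊕ a)         ≡⟨ toℕ-⊕ 𝟘 a ⟩
    (toℕ 𝟘 + toℕ a) % n ≡⟨ cong (λ r → (r + toℕ a) % n) toℕ-𝟘 ⟩
    toℕ a % n           ≡⟨ m<n⇒m%n≡m (toℕ<n a) ⟩
    toℕ a               ∎)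
    where open ≡-Reasoning

  ⊕-inverseʳ : ∀ (a : Fin n) → a ⊕ (⊖ a) ≡ 𝟘
  ⊕-inverseʳ a = toℕ-injective (begin
    toℕ (a ⊕ (⊖ a))               ≡⟨ toℕ-⊕ a (⊖ a) ⟩
    (toℕ a + toℕ (⊖ a)) % n       ≡⟨ cong (λ r → (toℕ a + r) % n) (toℕ-mod (n ∸ toℕ a)) ⟩
    (toℕ a + (n ∸ toℕ a) % n) % n ≡⟨ [m+k%n]%n≡[m+k]%n (toℕ a) (n ∸ toℕ a) ⟩
    (toℕ a + (n ∸ toℕ a)) % n     ≡⟨ cong (_% n) (m+[n∸m]≡n (<⇒≤ (toℕ<n a))) ⟩
    n % n                         ≡⟨ n%n≡0 n ⟩
    0                             ≡⟨ toℕ-𝟘 ⟨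
    toℕ 𝟘                         ∎)
    where open ≡-Reasoning

  ℤ/nℤ : AbelianGroup 0ℓ 0ℓ
  ℤ/nℤ = record
    { Carrier = Fin n ; _≈_ = _≡_ ; _∙_ = _⊕_ ; ε = 𝟘 ; _⁻¹ = ⊖_
    ; isAbelianGroup = record
      { isGroup = record
        { isMonoid = record
          { isSemigroup = record
            { isMagma = record { isEquivalence = isEquivalence ; ∙-cong = cong₂ _⊕_ }
            ; assoc = ⊕-assoc }
          ; identity = ⊕-identityˡ , λ a → trans (⊕-comm a 𝟘) (⊕-identityˡ a) }
        ; inverse = (λ a → trans (⊕-comm (⊖ a) a) (⊕-inverseʳ a)) , ⊕-inverseʳ
        ; ⁻¹-cong = cong ⊖_ }
      ; comm = ⊕-comm } }

  open AbelianGroup ℤ/nℤ public using () renaming (identityʳ to ⊕-identityʳ)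
  open AbelianGroupProperties ℤ/nℤ public
    using (identityʳ-unique; x∙y⁻¹≈ε⇒x≈y; x≈y⇒x∙y⁻¹≈ε) renaming (∙-cancelˡ to ⊕-cancelˡ; ∙-cancelʳ to ⊕-cancelʳ)
  open CommutativeSemigroupProperties (AbelianGroup.commutativeSemigroup ℤ/nℤ) public
    using (xy∙z≈y∙xz; xy∙z≈x∙zy)

  ≢𝟘⇒1≤toℕ : ∀ {a : Fin n} → a ≢ 𝟘 → 1 ≤ toℕ a
  ≢𝟘⇒1≤toℕ a≢𝟘 = n≢0⇒n>0 (λ a≡0 → a≢𝟘 (toℕ-injective (trans a≡0 (sym toℕ-𝟘))))

  ∑ : List (Fin n) → Fin n
  ∑ = foldr _⊕_ 𝟘

  ∑-++ : ∀ xs ys → ∑ (xs ++ ys) ≡ ∑ xs ⊕ ∑ ys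
  ∑-++ []       ys = sym (⊕-identityˡ (∑ ys))
  ∑-++ (x ∷ xs) ys = trans (cong (x ⊕_) (∑-++ xs ys)) (sym (⊕-assoc x (∑ xs) (∑ ys)))

  toℕ-∑-replicate : ∀ k a → toℕ (∑ (replicate k a)) ≡ k * toℕ a % n
  toℕ-∑-replicate zero    a = trans toℕ-𝟘 (sym (m<n⇒m%n≡m (>-nonZero⁻¹ n)))
  toℕ-∑-replicate (suc k) a = begin
    toℕ (a ⊕ ∑ (replicate k a))             ≡⟨ toℕ-⊕ a _ ⟩
    (toℕ a + toℕ (∑ (replicate k a))) % n   ≡⟨ cong (λ r → (toℕ a + r) % n) (toℕ-∑-replicate k a) ⟩
    (toℕ a + k * toℕ a % n) % n             ≡⟨ [m+k%n]%n≡[m+k]%n (toℕ a) (k * toℕ a) ⟩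
    suc k * toℕ a % n                       ∎
    where open ≡-Reasoning

  ∑-replicate≡𝟘⇔∣ : ∀ k a → ∑ (replicate k a) ≡ 𝟘 ⇔ n ∣ k * toℕ a
  ∑-replicate≡𝟘⇔∣ k a = mk⇔
    (λ e → m%n≡0⇒n∣m _ n (trans (sym (toℕ-∑-replicate k a)) (trans (cong toℕ e) toℕ-𝟘)))
    (λ n∣ → toℕ-injective (trans (toℕ-∑-replicate k a) (trans (n∣m⇒m%n≡0 _ n n∣) (sym toℕ-𝟘))))

  ZeroSumFree : List (Fin n) → Set
  ZeroSumFree xs = ∀ L R → xs ↭ L ++ R → L ≢ [] → ∑ L ≢ 𝟘

  zeroSumFree-resp-↭ : ∀ {xs ys} → xs ↭ ys → ZeroSumFree xs → ZeroSumFree ys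
  zeroSumFree-resp-↭ xs↭ys zsf L R ys↭ = zsf L R (↭-trans xs↭ys ys↭)

  zeroSumFree-∷ : ∀ {x xs} → ZeroSumFree (x ∷ xs) → ZeroSumFree xs
  zeroSumFree-∷ {x} zsf L R xs↭ = zsf L (x ∷ R) (↭-trans (↭-prep x xs↭) (↭-sym (shift x L R)))

  zeroSumFree-∈ : ∀ {x xs} → ZeroSumFree xs → x ∈ xs → x ≢ 𝟘
  zeroSumFree-∈ {x} zsf x∈ x≡𝟘 with ∈⇒↭∷ x∈
  ... | ys , xs↭ = zsf (x ∷ []) ys xs↭ (λ ()) (trans (⊕-identityʳ x) x≡𝟘)

  prefixSums : Fin n → List (Fin n) → List (Fin n)
  prefixSums z []       = z ∷ []
  prefixSums z (x ∷ xs) = z ∷ prefixSums (z ⊕ x) xs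

  length-prefixSums : ∀ z xs → length (prefixSums z xs) ≡ suc (length xs)
  length-prefixSums z []       = refl
  length-prefixSums z (x ∷ xs) = cong suc (length-prefixSums (z ⊕ x) xs)

  ∈-prefixSums⁻ : ∀ z xs {y} → y ∈ prefixSums z xs → ∃₂ λ P Q → xs ≡ P ++ Q × y ≡ z ⊕ ∑ P
  ∈-prefixSums⁻ z []       (here refl) = [] , [] , refl , sym (⊕-identityʳ z)
  ∈-prefixSums⁻ z (x ∷ xs) (here refl) = [] , x ∷ xs , refl , sym (⊕-identityʳ z)
  ∈-prefixSums⁻ z (x ∷ xs) (there y∈) with ∈-prefixSums⁻ (z ⊕ x) xs y∈
  ... | P , Q , refl , refl = x ∷ P , Q , refl , ⊕-assoc z x (∑ P)

  ∉-prefixSums : ∀ z {x xs} → ZeroSumFree (x ∷ xs) → z ∉ prefixSums (z ⊕ x) xs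
  ∉-prefixSums z {x} {xs} zsf z∈ with ∈-prefixSums⁻ (z ⊕ x) xs z∈
  ... | P , Q , refl , z≡ = zsf (x ∷ P) Q ↭-refl (λ ())
    (identityʳ-unique z (x ⊕ ∑ P) (sym (trans z≡ (⊕-assoc z x (∑ P)))))

  prefixSums-unique : ∀ z xs → ZeroSumFree xs → Unique (prefixSums z xs)
  prefixSums-unique z []       _   = [] ∷ []
  prefixSums-unique z (x ∷ xs) zsf =
    ¬Any⇒All¬ _ (∉-prefixSums z zsf) ∷ prefixSums-unique (z ⊕ x) xs (zeroSumFree-∷ zsf)

  zeroSumFree⇒length< : ∀ {xs} → ZeroSumFree xs → length xs < n
  zeroSumFree⇒length< {xs} zsf =
    subst (_≤ n) (length-prefixSums 𝟘 xs) (unique⇒length≤ (prefixSums-unique 𝟘 xs zsf))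

  -- Were a ≠ b, the n + 1 residues b, 0, a, a + b, a + b + x₁, … would be distinct.
  zeroSumFree-maximal⇒constant : ∀ {a A} → ZeroSumFree (a ∷ A) → suc (length (a ∷ A)) ≡ n → All (a ≡_) A
  zeroSumFree-maximal⇒constant {a} {A} zsf len = All.tabulate a≡
    where
    a≡ : ∀ {b} → b ∈ A → a ≡ b
    a≡ {b} b∈ with a ≟ b | ∈⇒↭∷ b∈
    ... | yes a≡b | _        = a≡b
    ... | no  a≢b | A′ , A↭  =
      contradiction (unique⇒length≤ residues-unique) (subst (λ m → ¬ m ≤ n) (sym count) 1+n≰n)
      where
      zsf′ : ZeroSumFree (a ∷ b ∷ A′)
      zsf′ = zeroSumFree-resp-↭ (↭-prep a A↭) zsf
      b∉ : b ∉ prefixSums (a ⊕ b) A′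
      b∉ b∈ with ∈-prefixSums⁻ (a ⊕ b) A′ b∈
      ... | P , Q , refl , b≡ = zsf′ (a ∷ P) (b ∷ Q) (↭-prep a (↭-sym (shift b P Q))) (λ ())
        (identityʳ-unique b (a ⊕ ∑ P) (sym (trans b≡ (xy∙z≈y∙xz a b (∑ P)))))
      𝟘∉ : 𝟘 ∉ prefixSums a (b ∷ A′)
      𝟘∉ = subst (λ w → 𝟘 ∉ prefixSums w (b ∷ A′)) (⊕-identityˡ a) (∉-prefixSums 𝟘 zsf′)
      residues-unique : Unique (b ∷ 𝟘 ∷ prefixSums a (b ∷ A′))
      residues-unique =
        (zeroSumFree-∈ zsf′ (there (here refl)) ∷ (a≢b ∘ sym) ∷ ¬Any⇒All¬ _ b∉)
        ∷ ¬Any⇒All¬ _ 𝟘∉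
        ∷ prefixSums-unique a (b ∷ A′) (zeroSumFree-∷ zsf′)
      count : length (b ∷ 𝟘 ∷ prefixSums a (b ∷ A′)) ≡ suc n
      count = trans (cong (2 +_) (length-prefixSums a (b ∷ A′))) (trans (cong (3 +_) (sym (↭-length A↭))) (cong suc len))

  zeroSumFree-replicate⇒coprime : ∀ {a} → ZeroSumFree (replicate (n ∸ 1) a) → gcd (toℕ a) n ≡ 1
  zeroSumFree-replicate⇒coprime {a} zsf = ∤*⇒coprime (>-nonZero⁻¹ n) λ {k} 0<k k<n n∣ka →
    zsf (replicate k a) (replicate (n ∸ 1 ∸ k) a) (↭-reflexive (split k<n)) (nonempty 0<k)
      (Equivalence.from (∑-replicate≡𝟘⇔∣ k a) n∣ka)
    where
    split : ∀ {k} → k < n → replicate (n ∸ 1) a ≡ replicate k a ++ replicate (n ∸ 1 ∸ k) a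
    split {k} k<n = trans (cong (λ m → replicate m a) (sym (m+[n∸m]≡n (suc[m]≤n⇒m≤pred[n] k<n)))) (replicate-++ k)
      where
      replicate-++ : ∀ k {m} → replicate (k + m) a ≡ replicate k a ++ replicate m a
      replicate-++ zero    = refl
      replicate-++ (suc k) = cong (a ∷_) (replicate-++ k)
    nonempty : ∀ {k} → 0 < k → replicate k a ≢ []
    nonempty {suc k} _ ()

  ReflectionPairFree : List (Fin n) → List (Fin n) → Set
  ReflectionPairFree As Bs =
    ∀ L R {u v Bs′} → As ↭ L ++ R → Bs ↭ u ∷ Bs′ → v ∈ Bs′ → v ⊕ ∑ L ≢ u

  reflectionPairFree-∷ : ∀ {As x Bs} → ReflectionPairFree As (x ∷ Bs) → ReflectionPairFree As Bs
  reflectionPairFree-∷ {x = x} rpf L R As↭ Bs↭ v∈ =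
    rpf L R As↭ (↭-trans (↭-prep x Bs↭) (↭-swap x _ ↭-refl)) (there v∈)

  reflectionPairFree⇒unique : ∀ {As Bs} → ReflectionPairFree As Bs → Unique Bs
  reflectionPairFree⇒unique {Bs = []}     _   = []
  reflectionPairFree⇒unique {Bs = x ∷ Bs} rpf =
    All.tabulate (λ y∈ x≡y → rpf [] _ ↭-refl ↭-refl y∈ (trans (⊕-identityʳ _) (sym x≡y)))
    ∷ reflectionPairFree⇒unique (reflectionPairFree-∷ rpf)

  -- The residues c + Σ P (P a prefix of a ∷ A), d and b + Σ (a ∷ A) (b ∈ d ∷ B) are distinct.
  twoReflections-length< : ∀ {a A c d B} → ZeroSumFree (a ∷ A) → ReflectionPairFree (a ∷ A) (c ∷ d ∷ B) →
                         length (a ∷ A) + length (c ∷ d ∷ B) < n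
  twoReflections-length< {a} {A} {c} {d} {B} zsf rpf =
    subst (_≤ n) count (unique⇒length≤ (Unique-++⁺ (prefixSums-unique c As zsf) translates-unique disjoint))
    where
    As = a ∷ A
    σ = ∑ As
    As↭As++[] : As ↭ As ++ []
    As↭As++[] = ↭-sym (++-identityʳ As)
    translates : List (Fin n)
    translates = d ∷ map (_⊕ σ) (d ∷ B)
    d∉ : ∀ {y} → y ∈ map (_⊕ σ) (d ∷ B) → d ≢ y
    d∉ (here d≡) e = zsf As [] As↭As++[] (λ ()) (identityʳ-unique d σ (sym (trans e d≡)))
    d∉ (there y∈) e with ∈-map⁻ (_⊕ σ) y∈
    ... | b , b∈ , refl = rpf As [] As↭As++[] (↭-swap c d ↭-refl) (there b∈) (sym e)
    translates-unique : Unique translates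
    translates-unique = All.tabulate d∉
      ∷ Unique-map⁺ (⊕-cancelʳ σ _ _) (reflectionPairFree⇒unique (reflectionPairFree-∷ rpf))
    disjoint : Disjoint (prefixSums c As) translates
    disjoint (y∈ , y∈′) with ∈-prefixSums⁻ c As y∈
    ... | P , Q , As≡P++Q , refl = prefix∉ y∈′
      where
      prefix∉ : c ⊕ ∑ P ∉ translates
      prefix∉ (here e) = rpf P Q (↭-reflexive As≡P++Q) (↭-swap c d ↭-refl) (here refl) e
      prefix∉ (there y∈map) with ∈-map⁻ (_⊕ σ) y∈map
      ... | b , b∈ , e = rpf Q P (↭-trans (↭-reflexive As≡P++Q) (++-comm P Q)) ↭-refl b∈ (⊕-cancelʳ (∑ P) _ _ (begin
        (b ⊕ ∑ Q) ⊕ ∑ P ≡⟨ xy∙z≈x∙zy b (∑ Q) (∑ P) ⟩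
        b ⊕ (∑ P ⊕ ∑ Q) ≡⟨ cong (b ⊕_) (trans (sym (∑-++ P Q)) (cong ∑ (sym As≡P++Q))) ⟩
        b ⊕ σ           ≡⟨ e ⟨
        c ⊕ ∑ P         ∎))
        where open ≡-Reasoning
    count : length (prefixSums c As ++ translates) ≡ suc (length As + length (c ∷ d ∷ B))
    count = trans (length-++ (prefixSums c As))
      (cong₂ _+_ (length-prefixSums c As) (cong (2 +_) (length-map (_⊕ σ) B)))

rot-injective : ∀ {n} {a b : Fin n} → rot a ≡ rot b → a ≡ b
rot-injective refl = refl

ref≢rot : ∀ {n} {a b : Fin n} → ref a ≢ rot b
ref≢rot ()

split : ∀ {n} (S : List (D n)) → ∃₂ λ As Bs → S ↭ map rot As ++ map ref Bs
split []          = [] , [] , ↭-refl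
split (rot a ∷ S) with split S
... | As , Bs , S↭ = a ∷ As , Bs , ↭-prep (rot a) S↭
split (ref b ∷ S) with split S
... | As , Bs , S↭ = As , b ∷ Bs , ↭-trans (↭-prep (ref b) S↭) (↭-sym (shift (ref b) (map rot As) (map ref Bs)))

length-split : ∀ {n} {S : List (D n)} {As Bs} → S ↭ map rot As ++ map ref Bs → length S ≡ length As + length Bs
length-split {As = As} {Bs} S↭ =
  trans (↭-length S↭) (trans (length-++ (map rot As)) (cong₂ _+_ (length-map rot As) (length-map ref Bs)))

isReflection : ∀ {n} → D n → ℕ
isReflection (rot _) = 0
isReflection (ref _) = 1

reflectionCount : ∀ {n} → List (D n) → ℕ
reflectionCount = sum ∘ map isReflection

reflectionCount-++ : ∀ {n} (xs ys : List (D n)) → reflectionCount (xs ++ ys) ≡ reflectionCount xs + reflectionCount ys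
reflectionCount-++ xs ys = trans (cong sum (map-++ isReflection xs ys)) (sum-++ (map isReflection xs) (map isReflection ys))

reflectionCount-↭ : ∀ {n} {xs ys : List (D n)} → xs ↭ ys → reflectionCount xs ≡ reflectionCount ys
reflectionCount-↭ xs↭ys = sum-↭ (map⁺ isReflection xs↭ys)

reflectionCount≡0⇒ref∉ : ∀ {n} {xs : List (D n)} {b} → reflectionCount xs ≡ 0 → ref b ∉ xs
reflectionCount≡0⇒ref∉ {xs = rot _ ∷ xs} count≡0 (there b∈) = reflectionCount≡0⇒ref∉ {xs = xs} count≡0 b∈

reflectionCount-↭++ : ∀ {n} {S L R : List (D n)} → S ↭ L ++ R → reflectionCount L ≤ reflectionCount S
reflectionCount-↭++ {L = L} {R} S↭ =
  subst (reflectionCount L ≤_) (trans (sym (reflectionCount-++ L R)) (sym (reflectionCount-↭ S↭))) (m≤m+n _ _)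

reflectionCount-standard : ∀ {n} m {t s : Fin n} → reflectionCount (replicate m (rot t) ++ ref s ∷ []) ≡ 1
reflectionCount-standard zero    = refl
reflectionCount-standard (suc m) = reflectionCount-standard m

∈-standard : ∀ {n} m {t s : Fin n} {x} → x ∈ replicate m (rot t) ++ ref s ∷ [] → x ≡ rot t ⊎ x ≡ ref s
∈-standard zero    (here x≡)  = inj₂ x≡
∈-standard (suc m) (here x≡)  = inj₁ x≡
∈-standard (suc m) (there x∈) = ∈-standard m x∈

module _ {n : ℕ} .{{_ : NonZero n}} where

  prod-map-rot : ∀ xs → prod (map rot xs) ≡ rot (∑ xs)
  prod-map-rot []       = refl
  prod-map-rot (x ∷ xs) = cong (rot x ·_) (prod-map-rot xs)

  prod-replicate-rot : ∀ k a → prod (replicate k (rot a)) ≡ rot (∑ (replicate k a))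
  prod-replicate-rot k a = trans (cong prod (sym (map-replicate rot k a))) (prod-map-rot (replicate k a))

  prod-refPair≡one⇔ : ∀ u v L → prod (ref u ∷ ref v ∷ map rot L) ≡ one ⇔ v ⊕ ∑ L ≡ u
  prod-refPair≡one⇔ u v L = mk⇔
    (λ prod≡one → x∙y⁻¹≈ε⇒x≈y _ _ (rot-injective (trans (sym prod≡rot) prod≡one)))
    (λ balanced → trans prod≡rot (cong rot (x≈y⇒x∙y⁻¹≈ε balanced)))
    where
    prod≡rot : prod (ref u ∷ ref v ∷ map rot L) ≡ rot ((v ⊕ ∑ L) ⊕ (⊖ u))
    prod≡rot = cong (λ g → ref u · (ref v · g)) (prod-map-rot L)

  reflectionCount≡0⇒prod≡rot : ∀ {xs : List (D n)} → reflectionCount xs ≡ 0 → ∃[ a ] prod xs ≡ rot a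
  reflectionCount≡0⇒prod≡rot {[]}        _       = 𝟘 , refl
  reflectionCount≡0⇒prod≡rot {rot x ∷ xs} count≡0 with reflectionCount≡0⇒prod≡rot {xs} count≡0
  ... | a , prod≡ = x ⊕ a , cong (rot x ·_) prod≡

  reflectionCount≡1⇒prod≡ref : ∀ {xs : List (D n)} → reflectionCount xs ≡ 1 → ∃[ b ] prod xs ≡ ref b
  reflectionCount≡1⇒prod≡ref {rot x ∷ xs} count≡1 with reflectionCount≡1⇒prod≡ref {xs} count≡1
  ... | b , prod≡ = b ⊕ (⊖ x) , cong (rot x ·_) prod≡
  reflectionCount≡1⇒prod≡ref {ref y ∷ xs} count≡1 with reflectionCount≡0⇒prod≡rot {xs} (suc-injective count≡1)
  ... | a , prod≡ = y ⊕ a , cong (ref y ·_) prod≡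

  hasProduct1Subseq-resp-↭ : ∀ {S S′ : List (D n)} → S ↭ S′ → HasProduct1Subseq S → HasProduct1Subseq S′
  hasProduct1Subseq-resp-↭ S↭S′ (L , R , S↭ , L≢[] , prod≡one) =
    L , R , ↭-trans (↭-sym S↭S′) S↭ , L≢[] , prod≡one

  product1Free-resp-↭ : ∀ {S S′ : List (D n)} → S ↭ S′ → Product1Free S → Product1Free S′
  product1Free-resp-↭ S↭S′ free = free ∘ hasProduct1Subseq-resp-↭ (↭-sym S↭S′)

  product1Free⇒zeroSumFree : ∀ {As Bs} → Product1Free (map rot As ++ map ref Bs) → ZeroSumFree As
  product1Free⇒zeroSumFree {As} {Bs} free L R As↭ L≢[] ∑L≡𝟘 =
    free (map rot L , map rot R ++ map ref Bs , perm , map≢[] rot L≢[] , trans (prod-map-rot L) (cong rot ∑L≡𝟘))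
    where
    open PermutationReasoning
    perm : map rot As ++ map ref Bs ↭ map rot L ++ (map rot R ++ map ref Bs)
    perm = begin
      map rot As ++ map ref Bs               ↭⟨ ++⁺ʳ (map ref Bs) (map⁺ rot As↭) ⟩
      map rot (L ++ R) ++ map ref Bs         ≡⟨ cong (_++ map ref Bs) (map-++ rot L R) ⟩
      (map rot L ++ map rot R) ++ map ref Bs ≡⟨ ++-assoc (map rot L) (map rot R) (map ref Bs) ⟩
      map rot L ++ (map rot R ++ map ref Bs) ∎

  product1Free⇒reflectionPairFree : ∀ {As Bs} → Product1Free (map rot As ++ map ref Bs) → ReflectionPairFree As Bs
  product1Free⇒reflectionPairFree {As} {Bs} free L R {u} {v} As↭ Bs↭ v∈ balanced with ∈⇒↭∷ v∈
  ... | Q , Bs′↭ = free (ref u ∷ ref v ∷ map rot L , map rot R ++ map ref Q , perm , (λ ())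
                        , Equivalence.from (prod-refPair≡one⇔ u v L) balanced)
    where
    open PermutationReasoning
    open CommutativeSemigroupProperties (CommutativeMonoid.commutativeSemigroup (++-commutativeMonoid {A = D n}))
      using (interchange)
    perm : map rot As ++ map ref Bs ↭ (ref u ∷ ref v ∷ map rot L) ++ (map rot R ++ map ref Q)
    perm = begin
      map rot As ++ map ref Bs
        ↭⟨ ++⁺ (map⁺ rot As↭) (map⁺ ref (↭-trans Bs↭ (↭-prep u Bs′↭))) ⟩
      map rot (L ++ R) ++ pair ++ map ref Q
        ≡⟨ cong (_++ _) (map-++ rot L R) ⟩
      (map rot L ++ map rot R) ++ pair ++ map ref Q
        ↭⟨ interchange (map rot L) (map rot R) pair (map ref Q) ⟩
      (map rot L ++ pair) ++ (map rot R ++ map ref Q)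
        ↭⟨ ++⁺ʳ _ (++-comm (map rot L) pair) ⟩
      (pair ++ map rot L) ++ (map rot R ++ map ref Q) ∎
      where pair = ref u ∷ ref v ∷ []

Standard : (n : ℕ) .{{_ : NonZero n}} → List (D n) → Set
Standard n S = ∃[ t ] ∃[ s ] ((1 ≤ toℕ t) × (gcd (toℕ t) n ≡ 1) × (S ↭ replicate (n ∸ 1) (rot t) ++ (ref s ∷ [])))

module _ {n : ℕ} .{{_ : NonZero n}} where

  zeroSumFree⇒standard : ∀ {a A s} → ZeroSumFree (a ∷ A) → suc (length (a ∷ A)) ≡ n →
                         Standard n (map rot (a ∷ A) ++ ref s ∷ [])
  zeroSumFree⇒standard {a} {A} {s} zsf len =
    a , s , ≢𝟘⇒1≤toℕ (zeroSumFree-∈ zsf (here refl)) , zeroSumFree-replicate⇒coprime (subst ZeroSumFree a∷A≡ zsf)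
      , ↭-reflexive (cong (_++ ref s ∷ []) (trans (cong (map rot) a∷A≡) (map-replicate rot (n ∸ 1) a)))
    where
    a∷A≡ : a ∷ A ≡ replicate (n ∸ 1) a
    a∷A≡ = trans (cong (a ∷_) (All≡⇒replicate (zeroSumFree-maximal⇒constant zsf len)))
                 (cong (λ m → replicate (m ∸ 1) a) len)

  product1Free-classification : 2 ≤ n → (S : List (D n)) → length S ≡ n → Product1Free S →
                                Standard n S ⊎ ∃[ Bs ] (Unique Bs × length Bs ≡ n × S ↭ map ref Bs)
  product1Free-classification 2≤n S len free with split S
  ... | As , Bs , S↭ = classify As Bs S↭ (trans (sym (length-split {As = As} {Bs} S↭)) len) (product1Free-resp-↭ S↭ free)
    where
    classify : ∀ As Bs → S ↭ map rot As ++ map ref Bs → length As + length Bs ≡ n →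
               Product1Free (map rot As ++ map ref Bs) →
               Standard n S ⊎ ∃[ Bs ] (Unique Bs × length Bs ≡ n × S ↭ map ref Bs)
    classify As [] _ len free =
      contradiction (trans (sym (+-identityʳ _)) len)
        (<⇒≢ (zeroSumFree⇒length< (product1Free⇒zeroSumFree {As = As} {Bs = []} free)))
    classify [] (s ∷ []) _ refl _ = contradiction 2≤n λ { (s≤s ()) }
    classify (a ∷ A) (s ∷ []) S↭ len free
      with zeroSumFree⇒standard (product1Free⇒zeroSumFree {As = a ∷ A} {Bs = s ∷ []} free) (trans (+-comm 1 _) len)
    ... | t , s′ , 1≤t , coprime , T↭ = inj₁ (t , s′ , 1≤t , coprime , ↭-trans S↭ T↭)
    classify [] Bs@(_ ∷ _ ∷ _) S↭ len free =
      inj₂ (Bs , reflectionPairFree⇒unique (product1Free⇒reflectionPairFree {As = []} {Bs = Bs} free) , len , S↭)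
    classify (a ∷ A) (c ∷ d ∷ B) _ len free = contradiction len
      (<⇒≢ (twoReflections-length< (product1Free⇒zeroSumFree {As = a ∷ A} {Bs = c ∷ d ∷ B} free)
                                    (product1Free⇒reflectionPairFree free)))

  standard-rotationSubseq : ∀ {t s : Fin n} {L R} → replicate (n ∸ 1) (rot t) ++ ref s ∷ [] ↭ L ++ R →
                            reflectionCount L ≡ 0 → L ≡ replicate (length L) (rot t) × length L < n
  standard-rotationSubseq {t} {s} {L} {R} T↭ count≡0 = All≡⇒replicate (All.tabulate rot-t) , length<n
    where
    rot-t : ∀ {x} → x ∈ L → rot t ≡ x
    rot-t x∈ with ∈-standard (n ∸ 1) (∈-resp-↭ (↭-sym T↭) (∈-++⁺ˡ x∈))
    ... | inj₁ x≡rot = sym x≡rot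
    ... | inj₂ refl  = contradiction x∈ (reflectionCount≡0⇒ref∉ count≡0)
    length-L++R : length L + length R ≡ n
    length-L++R = begin
      length L + length R                         ≡⟨ length-++ L ⟨
      length (L ++ R)                             ≡⟨ ↭-length T↭ ⟨
      length (replicate (n ∸ 1) (rot t) ++ ref s ∷ []) ≡⟨ length-++ (replicate (n ∸ 1) (rot t)) ⟩
      length (replicate (n ∸ 1) (rot t)) + 1      ≡⟨ cong (_+ 1) (length-replicate (n ∸ 1)) ⟩
      n ∸ 1 + 1                                   ≡⟨ m∸n+n≡m (>-nonZero⁻¹ n) ⟩
      n                                           ∎
      where open ≡-Reasoning
    length<n : length L < n
    length<n with ∈-++⁻ L (∈-resp-↭ T↭ (∈-++⁺ʳ (replicate (n ∸ 1) (rot t)) (here refl)))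
    ... | inj₁ s∈L        = contradiction s∈L (reflectionCount≡0⇒ref∉ count≡0)
    ... | inj₂ (here _)   = subst (length L <_) length-L++R (m<m+n (length L) z<s)
    ... | inj₂ (there _)  = subst (length L <_) length-L++R (m<m+n (length L) z<s)

  standard-product1Free : ∀ {t s} → gcd (toℕ t) n ≡ 1 → Product1Free (replicate (n ∸ 1) (rot t) ++ ref s ∷ [])
  standard-product1Free {t} {s} coprime (L , R , T↭ , L≢[] , prodL≡one)
    with reflectionCount L in count≡ | reflectionCount-↭++ {L = L} {R} T↭
  ... | 0 | _ =
    let L≡ , length<n = standard-rotationSubseq {t} {s} {L} {R} T↭ count≡
        prodL≡rot = trans (cong prod L≡) (prod-replicate-rot (length L) t)
    in  coprime⇒∤* coprime (≢[]⇒0<length L≢[]) length<n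
          (Equivalence.to (∑-replicate≡𝟘⇔∣ (length L) t) (rot-injective (trans (sym prodL≡rot) prodL≡one)))
  ... | 1 | _ = ref≢rot (trans (sym (proj₂ (reflectionCount≡1⇒prod≡ref {xs = L} count≡))) prodL≡one)
  ... | suc (suc _) | 2≤count =
    contradiction (subst (2 ≤_) (reflectionCount-standard (n ∸ 1) {t} {s}) (≤-trans (s≤s (s≤s z≤n)) 2≤count))
      λ { (s≤s ()) }

prod-reflections≡one : ∀ {n} .{{_ : NonZero n}} {v w z : Fin n} → v ⊕ z ≡ w →
                       prod (ref 𝟘 ∷ ref v ∷ ref w ∷ ref z ∷ []) ≡ one
prod-reflections≡one {v = v} {w} {z} v⊕z≡w = cong rot (begin
  (v ⊕ ((z ⊕ 𝟘) ⊕ (⊖ w))) ⊕ (⊖ 𝟘) ≡⟨ cong (λ r → (v ⊕ (r ⊕ (⊖ w))) ⊕ (⊖ 𝟘)) (⊕-identityʳ z) ⟩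
  (v ⊕ (z ⊕ (⊖ w))) ⊕ (⊖ 𝟘)       ≡⟨ cong (_⊕ (⊖ 𝟘)) (⊕-assoc v z (⊖ w)) ⟨
  ((v ⊕ z) ⊕ (⊖ w)) ⊕ (⊖ 𝟘)       ≡⟨ cong (λ r → (r ⊕ (⊖ w)) ⊕ (⊖ 𝟘)) v⊕z≡w ⟩
  (w ⊕ (⊖ w)) ⊕ (⊖ 𝟘)             ≡⟨ cong (_⊕ (⊖ 𝟘)) (⊕-inverseʳ w) ⟩
  𝟘 ⊕ (⊖ 𝟘)                       ≡⟨ ⊕-inverseʳ 𝟘 ⟩
  𝟘                               ∎)
  where open ≡-Reasoning

residues₀₁₃₂ : ∀ m → List (Fin (4 + m))
residues₀₁₃₂ m = 𝟘 ∷ suc zero ∷ suc (suc (suc zero)) ∷ suc (suc zero) ∷ []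

residues₀₁₃₂-unique : ∀ m → Unique (residues₀₁₃₂ m)
residues₀₁₃₂-unique m = ((λ ()) ∷ (λ ()) ∷ (λ ()) ∷ []) ∷ ((λ ()) ∷ (λ ()) ∷ []) ∷ ((λ ()) ∷ []) ∷ [] ∷ []

prod-residues₀₁₃₂≡one : ∀ m → prod (map ref (residues₀₁₃₂ m)) ≡ one
prod-residues₀₁₃₂≡one m = prod-reflections≡one {v = suc zero} {suc (suc (suc zero))} {suc (suc zero)} refl

reflections-hasProduct1Subseq₄₊ : ∀ m {Bs : List (Fin (4 + m))} → Unique Bs → length Bs ≡ 4 + m →
                                  HasProduct1Subseq (map ref Bs)
reflections-hasProduct1Subseq₄₊ m unique len =
  let zs , Bs↭ = unique-⊆⇒↭++ (residues₀₁₃₂-unique m) (λ _ → unique∧length≡n⇒∈ unique len _)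
  in  map ref (residues₀₁₃₂ m) , map ref zs
      , ↭-trans (map⁺ ref Bs↭) (↭-reflexive (map-++ ref (residues₀₁₃₂ m) zs))
      , (λ ()) , prod-residues₀₁₃₂≡one m

reflections-hasProduct1Subseq : ∀ {n} .{{_ : NonZero n}} → 4 ≤ n → {Bs : List (Fin n)} →
                                Unique Bs → length Bs ≡ n → HasProduct1Subseq (map ref Bs)
reflections-hasProduct1Subseq {suc (suc (suc (suc m)))} (s≤s (s≤s (s≤s (s≤s _)))) =
  reflections-hasProduct1Subseq₄₊ m

reflections₃ : List (D 3)
reflections₃ = ref (# 0) ∷ ref (# 1) ∷ ref (# 2) ∷ []

unique⇒↭reflections₃ : ∀ {Bs : List (Fin 3)} → Unique Bs → length Bs ≡ 3 → map ref Bs ↭ reflections₃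
unique⇒↭reflections₃ unique len
  with unique-⊆⇒↭++ {xs = # 0 ∷ # 1 ∷ # 2 ∷ []} (((λ ()) ∷ (λ ()) ∷ []) ∷ ((λ ()) ∷ []) ∷ [] ∷ [])
                    (λ _ → unique∧length≡n⇒∈ unique len _)
... | [] , Bs↭    = map⁺ ref Bs↭
... | _ ∷ _ , Bs↭ = contradiction (trans (sym len) (↭-length Bs↭)) λ ()

reflections₃-product1Free : Product1Free reflections₃
reflections₃-product1Free (L , R , T↭ , L≢[] , prodL≡one) =
  go L (All-resp-↭ T↭ allReflections) (Unique-resp-↭ T↭ reflections₃-unique) (↭-length T↭) L≢[] prodL≡one
  where
  IsReflection : D 3 → Set
  IsReflection g = ∃[ u ] g ≡ ref u
  allReflections : All IsReflection reflections₃
  allReflections = (_ , refl) ∷ (_ , refl) ∷ (_ , refl) ∷ []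
  reflections₃-unique : Unique reflections₃
  reflections₃-unique = ((λ ()) ∷ (λ ()) ∷ []) ∷ ((λ ()) ∷ []) ∷ [] ∷ []
  go : ∀ L → All IsReflection (L ++ R) → Unique (L ++ R) → 3 ≡ length (L ++ R) → L ≢ [] → prod L ≢ one
  go []                  _                                          _               _  L≢[] _ = L≢[] refl
  go (_ ∷ [])            ((_ , refl) ∷ _)                           _               _  _    ()
  go (_ ∷ _ ∷ [])        ((u , refl) ∷ (v , refl) ∷ _)              ((u≢v ∷ _) ∷ _) _  _    prod≡one =
    u≢v (cong ref (sym (trans (sym (⊕-identityʳ v)) (Equivalence.to (prod-refPair≡one⇔ u v []) prod≡one))))
  go (_ ∷ _ ∷ _ ∷ [])    ((_ , refl) ∷ (_ , refl) ∷ (_ , refl) ∷ _) _               _  _    ()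
  go (_ ∷ _ ∷ _ ∷ _ ∷ _) _                                          _               ()

coprime₃ : ∀ {t : Fin 3} → t ≢ # 0 → gcd (toℕ t) 3 ≡ 1
coprime₃ {zero}             t≢0 = contradiction refl t≢0
coprime₃ {suc zero}         _   = refl
coprime₃ {suc (suc zero)}   _   = refl

product1Free⇔standard : (n : ℕ) .{{_ : NonZero n}} → 4 ≤ n → (S : List (D n)) → length S ≡ n →
                         Product1Free S ⇔ Standard n S
product1Free⇔standard n 4≤n S len = mk⇔ forward backward
  where
  forward : Product1Free S → Standard n S
  forward free with product1Free-classification (≤-trans (s≤s (s≤s z≤n)) 4≤n) S len free
  ... | inj₁ standard = standard
  ... | inj₂ (Bs , unique , length≡ , S↭) =
    contradiction (hasProduct1Subseq-resp-↭ (↭-sym S↭) (reflections-hasProduct1Subseq 4≤n unique length≡)) free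
  backward : Standard n S → Product1Free S
  backward (t , s , _ , coprime , S↭) = product1Free-resp-↭ (↭-sym S↭) (standard-product1Free coprime)

product1Free⇔₃ : (S : List (D 3)) → length S ≡ 3 →
                 Product1Free S ⇔
                 ((∃[ t ] ∃[ ν ] ((t ≢ # 0) × (S ↭ rot t ∷ rot t ∷ ref ν ∷ []))) ⊎ (S ↭ reflections₃))
product1Free⇔₃ S len = mk⇔ forward backward
  where
  Forms : Set
  Forms = (∃[ t ] ∃[ ν ] ((t ≢ # 0) × (S ↭ rot t ∷ rot t ∷ ref ν ∷ []))) ⊎ (S ↭ reflections₃)
  forward : Product1Free S → Forms
  forward free with product1Free-classification (s≤s (s≤s z≤n)) S len free
  ... | inj₁ (t , ν , 1≤t , _ , S↭)        = inj₁ (t , ν , (λ { refl → contradiction 1≤t λ () }) , S↭)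
  ... | inj₂ (Bs , unique , length≡ , S↭) = inj₂ (↭-trans S↭ (unique⇒↭reflections₃ unique length≡))
  backward : Forms → Product1Free S
  backward (inj₁ (t , ν , t≢0 , S↭)) = product1Free-resp-↭ (↭-sym S↭) (standard-product1Free (coprime₃ t≢0))
  backward (inj₂ S↭)                 = product1Free-resp-↭ (↭-sym S↭) reflections₃-product1Free

theorem1p3 :
    ((n : ℕ) .{{_ : NonZero n}} → 4 ≤ n → (S : List (D n)) → length S ≡ n →
      (Product1Free S ⇔
        (∃[ t ] ∃[ s ] ((1 ≤ toℕ t) × (gcd (toℕ t) n ≡ 1) ×
          (S ↭ replicate (n ∸ 1) (rot t) ++ (ref s ∷ []))))))
    ×
    ((S : List (D 3)) → length S ≡ 3 →
      (Product1Free S ⇔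
        ((∃[ t ] ∃[ ν ] ((t ≢ # 0) × (S ↭ rot t ∷ rot t ∷ ref ν ∷ [])))
         ⊎ (S ↭ ref (# 0) ∷ ref (# 1) ∷ ref (# 2) ∷ []))))
theorem1p3 = product1Free⇔standard , product1Free⇔₃
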